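{- Let $G$ be a mixed unit interval graph on $n$ vertices and $\mathcal{B}$ a $\mathcal{U}$-bubble model for $G$, decomposed into heavy parts $\hat{\mathcal{B}}_1,\dots,\hat{\mathcal{B}}_p$ in left-to-right order, where the light columns serving as borders are $C_0,C_1,\dots,C_p$ and $\hat{\mathcal{B}}_j$ has borders $C_{j-1}$ and $C_j$. Let $S=S_0\cup\dots\cup S_p$ be a fixed cut of the light columns, with $S_j\subseteq C_j$ for $j\in\{0,\dots,p\}$. Then the maximum size of a cut of $G$ that agrees with $S$ on the light columns is $$\mathrm{mcs}(G,S)=\sum_{j=1}^{p}\mathrm{mcs}\bigl(G(\hat{\mathcal{B}}_j),S_{j-1}\cup S_j\bigr)-\sum_{j=1}^{p-1}|S_j|\cdot|C_j\setminus S_j|,$$ where $\mathrm{mcs}(G(\hat{\mathcal{B}}_j),S_{j-1}\cup S_j)$ is the maximum size of a cut of $G(\hat{\mathcal{B}}_j)$ that agrees with $S_{j-1}\cup S_j$ on its borders $C_{j-1}\cup C_j$.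
   Context: A 2-dimensional $\mathcal{U}$-bubble structure for a finite nonempty set $A$ is a family $\mathcal{B}=\langle B_{i,j}\rangle_{1\le j\le k,\,1\le i\le r_j}$ of pairwise disjoint (possibly empty) sets ("bubbles") with union $A$, each partitioned into quadrants $B_{i,j}=B^{++}_{i,j}\cup B^{+- }_{i,j}\cup B^{ -+}_{i,j}\cup B^{ -- }_{i,j}$; $B^{*+}_{i,j}=B^{++}_{i,j}\cup B^{ -+}_{i,j}$, $B^{+*}_{i,j}=B^{++}_{i,j}\cup B^{+- }_{i,j}$. Column $j$ is the set of bubbles (or vertices) with second index $j$; row $i$ those with first index $i$. The graph $G(\mathcal{B})$ has vertex set $A$, and distinct $u,v$ are adjacent iff, for some ordering, $u\in B_{i,j}$, $v\in B_{i',j'}$ and: (a) $j=j'$; or (b) $j=j'-1$ and $i>i'$; or (c) $j=j'-1$, $i=i'$, $u\in B^{*+}_{i,j}$, $v\in B^{+*}_{i',j'}$. A $\mathcal{U}$-bubble model of $G$ is such a structure for $V(G)$ with $G\cong G(\mathcal{B})$, every row and column containing a nonempty bubble, $B_{r_j,j}\ne\emptyset$ for all $j$, and with $\mathrm{top}(j)=\min\{i:B_{i,j}\ne\emptyset\}$, $\mathrm{top}(1)=1$, $\mathrm{top}(j)\le \mathrm{top}(j+1)$. A mixed unit interval graph is an intersection graph of unit intervals, each closed, open or half-open. A column with more than $\sqrt{n}$ vertices is heavy, otherwise light. A heavy part is a maximal sequence of consecutive heavy columns together with the two light columns bordering it (its borders); if $\mathcal{B}$ starts or ends with a heavy column, an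 empty (light) column is added at the beginning or end. Two consecutive light columns also form a heavy part (with no heavy columns). Consecutive heavy parts share their common border column. For a heavy part $\hat{\mathcal{B}}$, $G(\hat{\mathcal{B}})$ is the subgraph of $G$ induced by the vertices in its columns. A cut is a vertex subset $X$ (with complement); its size is the number of edges with exactly one endpoint in $X$; a cut $X$ of a graph agrees with a cut $S$ of a subgraph $H$ if $X\cap V(H)=S$. -}

module Defs where

open import Data.Nat using (ℕ; zero; suc; _+_; _*_; _≤_; _<_; _≡ᵇ_; _<ᵇ_)
open import Data.Fin using (Fin; toℕ) renaming (zero to fzero; suc to fsuc)
open import Data.Bool using (Bool; true; false; _∧_; _∨_; not; _xor_; if_then_else_)
open import Data.Product using (Σ; _×_; ∃)
open import Data.Sum using (_⊎_)
open import Relation.Binary.PropositionalEquality using (_≡_; _≢_)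
open import Relation.Nullary using (¬_)
open import Data.Rational using (ℚ; 1ℚ) renaming (_+_ to _+ℚ_; _≤_ to _≤ℚ_; _<_ to _<ℚ_)

sumF : ∀ {n} → (Fin n → ℕ) → ℕ
sumF {zero}  f = 0
sumF {suc n} f = f fzero + sumF (λ v → f (fsuc v))

count : ∀ {n} → (Fin n → Bool) → ℕ
count P = sumF (λ v → if P v then 1 else 0)

sum1 : ℕ → (ℕ → ℕ) → ℕ
sum1 zero    f = 0
sum1 (suc m) f = sum1 m f + f (suc m)

record Graph (n : ℕ) : Set where
  field
    adj    : Fin n → Fin n → Bool
    sym    : ∀ u v → adj u v ≡ adj v u
    irrefl : ∀ v → adj v v ≡ false

-- Size of the cut X (X v ≡ true means v ∈ X) of the subgraph of G induced
-- by the vertex set W: the number of edges {u,v} (counted once, u < v)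
-- with u, v ∈ W and exactly one endpoint in X.
cutSize : ∀ {n} → Graph n → (W : Fin n → Bool) → (X : Fin n → Bool) → ℕ
cutSize G W X =
  sumF (λ u → count (λ v → (toℕ u <ᵇ toℕ v) ∧ W u ∧ W v ∧ Graph.adj G u v ∧ (X u xor X v)))

IsMcs : ∀ {n} → Graph n → (W : Fin n → Bool) → (D : Fin n → Set) → (S : Fin n → Bool) → ℕ → Set
IsMcs G W D S m =
  (Σ (_ → Bool) λ X → (∀ v → D v → X v ≡ S v) × cutSize G W X ≡ m)
  × (∀ X → (∀ v → D v → X v ≡ S v) → cutSize G W X ≤ m)

-- Mixed unit interval graphs: intervals of length 1 with rational left
-- endpoint `left`; `lc`/`rc` say whether the left/right end is closed.

record UInterval : Set where
  field
    left : ℚ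
    lc   : Bool
    rc   : Bool

MeetsFrom : UInterval → UInterval → Set
MeetsFrom I J =
  UInterval.left I ≤ℚ UInterval.left J ×
  (UInterval.left J <ℚ UInterval.left I +ℚ 1ℚ
   ⊎ (UInterval.left J ≡ UInterval.left I +ℚ 1ℚ × UInterval.rc I ≡ true × UInterval.lc J ≡ true))

Intersect : UInterval → UInterval → Set
Intersect I J = MeetsFrom I J ⊎ MeetsFrom J I

IsMixedUnitInterval : ∀ {n} → Graph n → Set
IsMixedUnitInterval {n} G =
  Σ (Fin n → UInterval) λ f →
    ∀ u v → u ≢ v → (Graph.adj G u v ≡ true → Intersect (f u) (f v))
                   × (Intersect (f u) (f v) → Graph.adj G u v ≡ true)

-- Vertex v lies in bubble B_{row v, col v}, columns 1..k, column j has
-- rows 1..r j.  Quadrant of v: first sign `fst v`, second sign `snd v`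
-- (true = +).  So v ∈ B^{*+} iff snd v ≡ true, v ∈ B^{+*} iff fst v ≡ true.
-- (Pairwise disjointness, union = Fin n, and the quadrant partition are
-- built into this encoding; bubbles may be empty.)

record BubbleStructure (n : ℕ) : Set where
  field
    k   : ℕ
    r   : ℕ → ℕ
    col : Fin n → ℕ
    row : Fin n → ℕ
    fst : Fin n → Bool
    snd : Fin n → Bool
    col-range : ∀ v → 1 ≤ col v × col v ≤ k
    row-range : ∀ v → 1 ≤ row v × row v ≤ r (col v)

module _ {n : ℕ} (B : BubbleStructure n) where
  open BubbleStructure B

  dirEdge : Fin n → Fin n → Bool
  dirEdge u v =
    (col u ≡ᵇ col v)
    ∨ ((col v ≡ᵇ suc (col u)) ∧ (row v <ᵇ row u))
    ∨ ((col v ≡ᵇ suc (col u)) ∧ (row u ≡ᵇ row v) ∧ snd u ∧ fst v)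

  bubbleAdj : Fin n → Fin n → Bool
  bubbleAdj u v = not (toℕ u ≡ᵇ toℕ v) ∧ (dirEdge u v ∨ dirEdge v u)

  record IsUModel : Set where
    field
      cols-nonempty   : ∀ j → 1 ≤ j → j ≤ k → ∃ λ v → col v ≡ j
      rows-nonempty   : ∀ i j → 1 ≤ j → j ≤ k → 1 ≤ i → i ≤ r j → ∃ λ v → row v ≡ i
      bottom-nonempty : ∀ j → 1 ≤ j → j ≤ k → ∃ λ v → col v ≡ j × row v ≡ r j
      top-first       : ∃ λ v → col v ≡ 1 × row v ≡ 1
      -- top(j) ≤ top(j+1)
      top-mono        : ∀ j → 1 ≤ j → j < k → ∀ v → col v ≡ suc j →
                          ∃ λ u → col u ≡ j × row u ≤ row v

  -- number of vertices in column j (columns 0 and k+1 are empty)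
  colSize : ℕ → ℕ
  colSize j = count (λ v → col v ≡ᵇ j)

  -- heavy: more than √n vertices, i.e. n < (size)^2
  Heavy : ℕ → Set
  Heavy j = n < colSize j * colSize j

  Light : ℕ → Set
  Light j = ¬ Heavy j

  -- b 0 < b 1 < ... < b p are the column indices of the border columns
  -- C_0, ..., C_p of the heavy-part decomposition; index 0 (resp. k+1)
  -- denotes the empty light column added in front (resp. at the end).
  record IsBorderSeq (p : ℕ) (b : ℕ → ℕ) : Set where
    field
      increasing : ∀ j → j < p → b j < b (suc j)
      borders-light : ∀ j → j ≤ p → Light (b j)
      all-light-borders : ∀ c → 1 ≤ c → c ≤ k → Light c → ∃ λ j → j ≤ p × b j ≡ c
      first : (Light 1 × b 0 ≡ 1) ⊎ (Heavy 1 × b 0 ≡ 0)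
      last  : (Light k × b p ≡ k) ⊎ (Heavy k × b p ≡ suc k)

  partV : (b : ℕ → ℕ) → ℕ → Fin n → Bool
  partV b j v = (b (j Data.Nat.∸ 1) Data.Nat.≤ᵇ col v) ∧ (col v Data.Nat.≤ᵇ b j)

  borderV : (b : ℕ → ℕ) → ℕ → Fin n → Set
  borderV b j v = col v ≡ b (j Data.Nat.∸ 1) ⊎ col v ≡ b j

  lightV : Fin n → Set
  lightV v = Light (col v)

  sizeIn : (b : ℕ → ℕ) → (S : Fin n → Bool) → ℕ → ℕ
  sizeIn b S j = count (λ v → (col v ≡ᵇ b j) ∧ S v)

  sizeOut : (b : ℕ → ℕ) → (S : Fin n → Bool) → ℕ → ℕ
  sizeOut b S j = count (λ v → (col v ≡ᵇ b j) ∧ not (S v))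

allV : ∀ {n} → Fin n → Bool
allV _ = true

module Submission where

-- An edge of G joins columns at distance at most one, so it lies in exactly one heavy part,
-- except that an edge inside an inner border column C_j lies in both parts sharing C_j.
-- Hence every cut X agreeing with S on the light columns satisfies
-- Σ_j cut(G(B̂_j), X) = cut(G, X) + Σ_j cut(G[C_j], X), and as columns are cliques the last
-- terms are |S_j| · |C_j ∖ S_j|.  Restricting an optimal cut of G to the parts gives one
-- inequality; optimal cuts of the parts coincide with S on the shared light borders and glue
-- to a cut of G, which gives the other.  With no parts, G is a single light column, so n ≤ 1.

open import Data.Bool using (Bool; true; false; _∧_; not; _xor_; if_then_else_; T)
open import Data.Bool.Properties using (∧-comm; ∧-zeroʳ)
open import Data.Empty using (⊥; ⊥-elim)
open import Data.Fin using (Fin; toℕ) renaming (zero to fzero; suc to fsuc)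
open import Data.Fin.Properties using (toℕ-injective; toℕ<n)
open import Data.Nat using (ℕ; zero; suc; _+_; _*_; _∸_; _≤_; _<_; _≡ᵇ_; _<ᵇ_; _≤ᵇ_; z≤n; s≤s)
open import Data.Nat.Properties
open import Algebra.Properties.CommutativeSemigroup +-commutativeSemigroup
  using (interchange; xy∙z≈xz∙y)
open import Data.Product using (Σ; _×_; _,_; proj₁; proj₂)
open import Data.Sum using (_⊎_; inj₁; inj₂)
open import Function using (_∘_)
open import Relation.Binary.PropositionalEquality
open import Relation.Binary.Definitions using (tri<; tri≈; tri>)
open import Relation.Nullary using (¬_; Dec; yes; no)
open import Relation.Nullary.Decidable using (dec-true; dec-false)
open import Defs

ind : Bool → ℕ
ind b = if b then 1 else 0

true⇒T : ∀ {b} → b ≡ true → T b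
true⇒T refl = _

∧-trueˡ : ∀ x {y} → x ∧ y ≡ true → x ≡ true
∧-trueˡ true _ = refl

∧-trueʳ : ∀ x {y} → x ∧ y ≡ true → y ≡ true
∧-trueʳ true eq = eq

∧-guarded-cong : ∀ x {y z} → (x ≡ true → y ≡ z) → x ∧ y ≡ x ∧ z
∧-guarded-cong false _ = refl
∧-guarded-cong true eq = eq refl

ind-guarded-* : ∀ x {m n} → (x ≡ true → m ≡ n) → ind x * m ≡ ind x * n
ind-guarded-* false _ = refl
ind-guarded-* true eq = cong (1 *_) (eq refl)

ind-∧-factor : ∀ l w w′ e → ind (l ∧ w ∧ w′ ∧ e) ≡ ind (l ∧ e) * ind (w ∧ w′)
ind-∧-factor false _     _     _ = refl
ind-∧-factor true  false _     e = sym (*-zeroʳ (ind e))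
ind-∧-factor true  true  false e = sym (*-zeroʳ (ind e))
ind-∧-factor true  true  true  e = sym (*-identityʳ (ind e))

∧-xor-self : ∀ a x → a ∧ a ∧ (x xor x) ≡ false
∧-xor-self false _     = refl
∧-xor-self true  false = refl
∧-xor-self true  true  = refl

∧-xor-comm : ∀ a c x y → a ∧ c ∧ (x xor y) ≡ c ∧ a ∧ (y xor x)
∧-xor-comm false false _     _     = refl
∧-xor-comm false true  _     _     = refl
∧-xor-comm true  false _     _     = refl
∧-xor-comm true  true  false false = refl
∧-xor-comm true  true  false true  = refl
∧-xor-comm true  true  true  false = refl
∧-xor-comm true  true  true  true  = refl

ind-∧-xor : ∀ a c x y →
  ind (a ∧ c ∧ (x xor y)) ≡ ind (a ∧ x) * ind (c ∧ not y) + ind (a ∧ not x) * ind (c ∧ y)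
ind-∧-xor false _     _     _     = refl
ind-∧-xor true  false x     _     = sym (cong₂ _+_ (*-zeroʳ (ind x)) (*-zeroʳ (ind (not x))))
ind-∧-xor true  true  false false = refl
ind-∧-xor true  true  false true  = refl
ind-∧-xor true  true  true  false = refl
ind-∧-xor true  true  true  true  = refl

≤ᵇ-true : ∀ {m n} → m ≤ n → (m ≤ᵇ n) ≡ true
≤ᵇ-true {m} {n} = dec-true (m ≤? n)

≤ᵇ-false : ∀ {m n} → n < m → (m ≤ᵇ n) ≡ false
≤ᵇ-false {m} {n} n<m = dec-false (m ≤? n) (<⇒≱ n<m)

<ᵇ-true : ∀ {m n} → m < n → (m <ᵇ n) ≡ true
<ᵇ-true {m} {n} = dec-true (m <? n)

<ᵇ-false : ∀ {m n} → n ≤ m → (m <ᵇ n) ≡ false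
<ᵇ-false {m} {n} n≤m = dec-false (m <? n) (≤⇒≯ n≤m)

≡ᵇ-true : ∀ {m n} → m ≡ n → (m ≡ᵇ n) ≡ true
≡ᵇ-true {m} {n} = dec-true (m ≟ n)

≡ᵇ-false : ∀ {m n} → m ≢ n → (m ≡ᵇ n) ≡ false
≡ᵇ-false {m} {n} = dec-false (m ≟ n)

n≮n*n⇒n≤1 : ∀ {n} → ¬ n < n * n → n ≤ 1
n≮n*n⇒n≤1 {zero}        _ = z≤n
n≮n*n⇒n≤1 {suc zero}    _ = ≤-refl
n≮n*n⇒n≤1 {suc (suc n)} n≮n*n = ⊥-elim (n≮n*n (m<m*n (2 + n) (2 + n) (s≤s (s≤s z≤n))))

uninhabited⇒≤1 : ∀ {n} → (Fin n → ⊥) → n ≤ 1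
uninhabited⇒≤1 {zero}  _     = z≤n
uninhabited⇒≤1 {suc n} empty = ⊥-elim (empty fzero)

bounded-choice : ∀ {A : Set} {P : ℕ → A → Set} p → A → (∀ j → 1 ≤ j → j ≤ p → Σ A (P j)) →
  Σ (ℕ → A) λ f → ∀ j → 1 ≤ j → j ≤ p → P j (f j)
bounded-choice {A} {P} p default choose = f , f-spec
  where
  f : ℕ → A
  f j with 1 ≤? j | j ≤? p
  ... | yes 1≤j | yes j≤p = proj₁ (choose j 1≤j j≤p)
  ... | _       | _       = default

  f-spec : ∀ j → 1 ≤ j → j ≤ p → P j (f j)
  f-spec j 1≤j j≤p with 1 ≤? j | j ≤? p
  ... | yes 1≤j′ | yes j≤p′ = proj₂ (choose j 1≤j′ j≤p′)
  ... | no  1≰j  | _        = ⊥-elim (1≰j 1≤j)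
  ... | yes _    | no  j≰p  = ⊥-elim (j≰p j≤p)

sumF-cong : ∀ {n} {f g : Fin n → ℕ} → (∀ u → f u ≡ g u) → sumF f ≡ sumF g
sumF-cong {zero}  _  = refl
sumF-cong {suc n} eq = cong₂ _+_ (eq fzero) (sumF-cong (eq ∘ fsuc))

sumF-zero : ∀ {n} {f : Fin n → ℕ} → (∀ u → f u ≡ 0) → sumF f ≡ 0
sumF-zero {zero}  _  = refl
sumF-zero {suc n} eq = cong₂ _+_ (eq fzero) (sumF-zero (eq ∘ fsuc))

sumF-+ : ∀ {n} (f g : Fin n → ℕ) → sumF (λ u → f u + g u) ≡ sumF f + sumF g
sumF-+ {zero}  _ _ = refl
sumF-+ {suc n} f g =
  trans (cong (f fzero + g fzero +_) (sumF-+ (f ∘ fsuc) (g ∘ fsuc)))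
        (interchange (f fzero) (g fzero) (sumF (f ∘ fsuc)) (sumF (g ∘ fsuc)))

sumF-*ˡ : ∀ {n} a (f : Fin n → ℕ) → sumF (λ u → a * f u) ≡ a * sumF f
sumF-*ˡ {zero}  a _ = sym (*-zeroʳ a)
sumF-*ˡ {suc n} a f =
  trans (cong (a * f fzero +_) (sumF-*ˡ a (f ∘ fsuc))) (sym (*-distribˡ-+ a (f fzero) _))

sumF-*ʳ : ∀ {n} a (f : Fin n → ℕ) → sumF (λ u → f u * a) ≡ sumF f * a
sumF-*ʳ a f = trans (sumF-cong (λ u → *-comm (f u) a)) (trans (sumF-*ˡ a f) (*-comm a (sumF f)))

sumF-comm : ∀ {m n} (F : Fin m → Fin n → ℕ) →
  sumF (λ u → sumF (F u)) ≡ sumF (λ v → sumF (λ u → F u v))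
sumF-comm {zero} {n} _ = sym (sumF-zero {n} (λ _ → refl))
sumF-comm {suc m} F =
  trans (cong (sumF (F fzero) +_) (sumF-comm (F ∘ fsuc)))
        (sym (sumF-+ (F fzero) (λ v → sumF (λ u → F (fsuc u) v))))

count-all : ∀ {n} {P : Fin n → Bool} → (∀ v → P v ≡ true) → count P ≡ n
count-all {zero}  _   = refl
count-all {suc n} all rewrite all fzero = cong suc (count-all (all ∘ fsuc))

count-guarded-cong : ∀ {n} (P : Fin n → Bool) {Q R : Fin n → Bool} →
  (∀ v → P v ≡ true → Q v ≡ R v) → count (λ v → P v ∧ Q v) ≡ count (λ v → P v ∧ R v)
count-guarded-cong P eq = sumF-cong (λ v → cong ind (∧-guarded-cong (P v) (eq v)))

sum1-cong : ∀ p {f g : ℕ → ℕ} → (∀ j → 1 ≤ j → j ≤ p → f j ≡ g j) → sum1 p f ≡ sum1 p g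
sum1-cong zero    _  = refl
sum1-cong (suc p) eq =
  cong₂ _+_ (sum1-cong p (λ j 1≤j j≤p → eq j 1≤j (m≤n⇒m≤1+n j≤p))) (eq (suc p) (s≤s z≤n) ≤-refl)

sum1-mono : ∀ p {f g : ℕ → ℕ} → (∀ j → 1 ≤ j → j ≤ p → f j ≤ g j) → sum1 p f ≤ sum1 p g
sum1-mono zero    _  = z≤n
sum1-mono (suc p) le =
  +-mono-≤ (sum1-mono p (λ j 1≤j j≤p → le j 1≤j (m≤n⇒m≤1+n j≤p))) (le (suc p) (s≤s z≤n) ≤-refl)

sum1-*ˡ : ∀ p a (f : ℕ → ℕ) → sum1 p (λ j → a * f j) ≡ a * sum1 p f
sum1-*ˡ zero    a _ = sym (*-zeroʳ a)
sum1-*ˡ (suc p) a f = trans (cong (_+ a * f (suc p)) (sum1-*ˡ p a f)) (sym (*-distribˡ-+ a _ _))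

sum1-sumF : ∀ {n} p (F : ℕ → Fin n → ℕ) →
  sum1 p (λ j → sumF (F j)) ≡ sumF (λ u → sum1 p (λ j → F j u))
sum1-sumF {n} zero _ = sym (sumF-zero {n} (λ _ → refl))
sum1-sumF (suc p) F =
  trans (cong (_+ sumF (F (suc p))) (sum1-sumF p F))
        (sym (sumF-+ (λ u → sum1 p (λ j → F j u)) (F (suc p))))

crosses : ∀ {n} → Graph n → (Fin n → Bool) → Fin n → Fin n → Bool
crosses G X u v = (toℕ u <ᵇ toℕ v) ∧ Graph.adj G u v ∧ (X u xor X v)

cutSize-weighted : ∀ {n} (G : Graph n) W X →
  cutSize G W X ≡ sumF (λ u → sumF (λ v → ind (crosses G X u v) * ind (W u ∧ W v)))
cutSize-weighted G W X = sumF-cong λ u → sumF-cong λ v →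
  ind-∧-factor (toℕ u <ᵇ toℕ v) (W u) (W v) (Graph.adj G u v ∧ (X u xor X v))

sum1-cutSize : ∀ {n} (G : Graph n) p (W : ℕ → Fin n → Bool) X →
  sum1 p (λ j → cutSize G (W j) X)
    ≡ sumF (λ u → sumF (λ v → ind (crosses G X u v) * sum1 p (λ j → ind (W j u ∧ W j v))))
sum1-cutSize {n} G p W X = begin
  sum1 p (λ j → cutSize G (W j) X)
    ≡⟨ sum1-cong p (λ j _ _ → cutSize-weighted G (W j) X) ⟩
  sum1 p (λ j → sumF (λ u → sumF (λ v → term j u v)))
    ≡⟨ sum1-sumF p (λ j u → sumF (term j u)) ⟩
  sumF (λ u → sum1 p (λ j → sumF (term j u)))
    ≡⟨ sumF-cong (λ u → sum1-sumF p (λ j → term j u)) ⟩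
  sumF (λ u → sumF (λ v → sum1 p (λ j → term j u v)))
    ≡⟨ sumF-cong (λ u → sumF-cong (λ v → sum1-*ˡ p (ind (crosses G X u v)) _)) ⟩
  sumF (λ u → sumF (λ v → ind (crosses G X u v) * sum1 p (λ j → ind (W j u ∧ W j v)))) ∎
  where
  open ≡-Reasoning
  term : ℕ → Fin n → Fin n → ℕ
  term j u v = ind (crosses G X u v) * ind (W j u ∧ W j v)

cutSize-cong : ∀ {n} (G : Graph n) W {X Y} →
  (∀ v → W v ≡ true → X v ≡ Y v) → cutSize G W X ≡ cutSize G W Y
cutSize-cong G W X≗Y = sumF-cong λ u → sumF-cong λ v → cong ind
  (cong ((toℕ u <ᵇ toℕ v) ∧_) (∧-guarded-cong (W u) λ Wu → ∧-guarded-cong (W v) λ Wv →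
    cong (Graph.adj G u v ∧_) (cong₂ _xor_ (X≗Y u Wu) (X≗Y v Wv))))

cutSize-trivial : ∀ {n} (G : Graph n) W X → n ≤ 1 → cutSize G W X ≡ 0
cutSize-trivial G W X n≤1 = sumF-zero λ u → sumF-zero λ v →
  cong (λ b → ind (b ∧ W u ∧ W v ∧ Graph.adj G u v ∧ (X u xor X v))) (<ᵇ-false (subst (_≤ toℕ u) (sym (toℕ≡0 v)) z≤n))
  where
  toℕ≡0 : ∀ v → toℕ v ≡ 0
  toℕ≡0 v = n≤0⇒n≡0 (≤-pred (≤-trans (toℕ<n v) n≤1))

IsClique : ∀ {n} → Graph n → (Fin n → Bool) → Set
IsClique {n} G W = ∀ u v → u ≢ v → W u ≡ true → W v ≡ true → Graph.adj G u v ≡ true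

-- The double sum plus its transpose counts every ordered pair of the clique with exactly one
-- vertex in X once, i.e. it is twice in · out.
cutSize-clique : ∀ {n} (G : Graph n) W X → IsClique G W →
  cutSize G W X ≡ count (λ v → W v ∧ X v) * count (λ v → W v ∧ not (X v))
cutSize-clique {n} G W X clique = *-cancelˡ-≡ _ _ 2 (begin
  2 * cut                                             ≡⟨ cong (cut +_) (+-identityʳ cut) ⟩
  cut + cut                                           ≡⟨ cong (cut +_) (sumF-comm term) ⟩
  sumF (λ u → sumF (term u)) + sumF (λ u → sumF (λ v → term v u))
    ≡⟨ sym (sumF-+ (λ u → sumF (term u)) (λ u → sumF (λ v → term v u))) ⟩
  sumF (λ u → sumF (term u) + sumF (λ v → term v u))
    ≡⟨ sumF-cong (λ u → sym (sumF-+ (term u) (λ v → term v u))) ⟩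
  sumF (λ u → sumF (λ v → term u v + term v u))
    ≡⟨ sumF-cong (λ u → sumF-cong (λ v → term-symmetrised u v)) ⟩
  sumF (λ u → sumF (λ v → inside u * outside v + outside u * inside v))
    ≡⟨ sumF-cong (λ u → sumF-+ (λ v → inside u * outside v) (λ v → outside u * inside v)) ⟩
  sumF (λ u → sumF (λ v → inside u * outside v) + sumF (λ v → outside u * inside v))
    ≡⟨ sumF-cong (λ u → cong₂ _+_ (sumF-*ˡ (inside u) outside) (sumF-*ˡ (outside u) inside)) ⟩
  sumF (λ u → inside u * out + outside u * in′)
    ≡⟨ sumF-+ (λ u → inside u * out) (λ u → outside u * in′) ⟩
  sumF (λ u → inside u * out) + sumF (λ u → outside u * in′)
    ≡⟨ cong₂ _+_ (sumF-*ʳ out inside) (trans (sumF-*ʳ in′ outside) (*-comm out in′)) ⟩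
  in′ * out + in′ * out                                ≡⟨ cong (in′ * out +_) (sym (+-identityʳ _)) ⟩
  2 * (in′ * out)                                     ∎)
  where
  open ≡-Reasoning
  inside outside : Fin n → ℕ
  inside v = ind (W v ∧ X v)
  outside v = ind (W v ∧ not (X v))

  cut in′ out : ℕ
  cut = cutSize G W X
  in′ = sumF inside
  out = sumF outside

  term : Fin n → Fin n → ℕ
  term u v = ind ((toℕ u <ᵇ toℕ v) ∧ W u ∧ W v ∧ Graph.adj G u v ∧ (X u xor X v))

  separates : Fin n → Fin n → ℕ
  separates u v = ind (W u ∧ W v ∧ (X u xor X v))

  term-below : ∀ u v → toℕ u < toℕ v → term u v ≡ separates u v
  term-below u v u<v rewrite <ᵇ-true u<v with W u in Wu | W v in Wv
  ... | false | _     = refl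
  ... | true  | false = refl
  ... | true  | true  rewrite clique u v (λ { refl → <-irrefl refl u<v }) Wu Wv = refl

  term-above : ∀ u v → toℕ v ≤ toℕ u → term u v ≡ 0
  term-above u v v≤u rewrite <ᵇ-false v≤u = refl

  term-symmetrised : ∀ u v → term u v + term v u ≡ inside u * outside v + outside u * inside v
  term-symmetrised u v with <-cmp (toℕ u) (toℕ v)
  ... | tri< u<v _ _ rewrite term-below u v u<v | term-above v u (<⇒≤ u<v) | +-identityʳ (separates u v) =
    ind-∧-xor (W u) (W v) (X u) (X v)
  ... | tri> _ _ v<u rewrite term-above u v (<⇒≤ v<u) | term-below v u v<u
                           | ∧-xor-comm (W v) (W u) (X v) (X u) = ind-∧-xor (W u) (W v) (X u) (X v)
  ... | tri≈ _ u≡v _ with refl ← toℕ-injective u≡v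
    rewrite term-above u u ≤-refl =
    trans (cong ind (sym (∧-xor-self (W u) (X u)))) (ind-∧-xor (W u) (W u) (X u) (X u))

-- The telescoping step of parts-containing, for a part [c , d].
part-step : ∀ {x y c d} → x ≤ y → y ≤ suc x → c ≤ d →
  ind (y ≤ᵇ c) + ind (((c ≤ᵇ x) ∧ (x ≤ᵇ d)) ∧ ((c ≤ᵇ y) ∧ (y ≤ᵇ d)))
    ≡ ind (y ≤ᵇ d) + ind ((x ≡ᵇ c) ∧ (y ≡ᵇ c))
part-step {x} {y} {c} {d} x≤y y≤1+x c≤d with m≤n⇒m<n∨m≡n x≤y | <-cmp x c
... | inj₂ refl | tri< x<c _ _
  rewrite ≤ᵇ-true (<⇒≤ x<c) | ≤ᵇ-false x<c | ≤ᵇ-true (≤-trans (<⇒≤ x<c) c≤d) | ≡ᵇ-false (<⇒≢ x<c) = refl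
... | inj₂ refl | tri≈ _ refl _ rewrite ≤ᵇ-true (≤-refl {x}) | ≤ᵇ-true c≤d | ≡ᵇ-true (refl {x = x}) = refl
... | inj₂ refl | tri> _ _ c<x rewrite ≤ᵇ-false c<x | ≤ᵇ-true (<⇒≤ c<x) | ≡ᵇ-false (>⇒≢ c<x) with x ≤? d
...   | yes x≤d rewrite ≤ᵇ-true x≤d = refl
...   | no  x≰d rewrite ≤ᵇ-false (≰⇒> x≰d) = refl
part-step {x} {y} {c} {d} x≤y y≤1+x c≤d | inj₁ x<y | cmp with refl ← ≤-antisym y≤1+x x<y with cmp
... | tri< x<c _ _
  rewrite ≤ᵇ-true x<c | ≤ᵇ-false x<c | ≤ᵇ-true (≤-trans x<c c≤d) | ≡ᵇ-false (<⇒≢ x<c) = refl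
... | tri≈ _ refl _
  rewrite ≤ᵇ-false (n<1+n x) | ≤ᵇ-true (≤-refl {x}) | ≤ᵇ-true c≤d | ≤ᵇ-true (n≤1+n x)
        | ≡ᵇ-true (refl {x = x}) | ≡ᵇ-false (1+n≢n {x}) = sym (+-identityʳ _)
... | tri> _ _ c<x
  rewrite ≤ᵇ-false (m<n⇒m<1+n c<x) | ≤ᵇ-true (<⇒≤ c<x) | ≡ᵇ-false (>⇒≢ c<x) | ≤ᵇ-true (m≤n⇒m≤1+n (<⇒≤ c<x))
  with suc x ≤? d
...   | yes 1+x≤d rewrite ≤ᵇ-true 1+x≤d | ≤ᵇ-true (<⇒≤ 1+x≤d) = refl
...   | no  1+x≰d rewrite ≤ᵇ-false (≰⇒> 1+x≰d) | ∧-zeroʳ (x ≤ᵇ d) = refl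

module Borders (b : ℕ → ℕ) (q : ℕ) (increasing : ∀ j → j < suc q → b j < b (suc j)) where

  p : ℕ
  p = suc q

  inPart : ℕ → ℕ → Bool
  inPart j c = (b (j ∸ 1) ≤ᵇ c) ∧ (c ≤ᵇ b j)

  inPart-bounds : ∀ j c → inPart j c ≡ true → b (j ∸ 1) ≤ c × c ≤ b j
  inPart-bounds j c c∈j =
    ≤ᵇ⇒≤ _ _ (true⇒T (∧-trueˡ (b (j ∸ 1) ≤ᵇ c) c∈j)) , ≤ᵇ⇒≤ _ _ (true⇒T (∧-trueʳ (b (j ∸ 1) ≤ᵇ c) c∈j))

  b-mono : ∀ {i j} → i ≤ j → j ≤ p → b i ≤ b j
  b-mono {j = zero}  i≤0 _ rewrite n≤0⇒n≡0 i≤0 = ≤-refl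
  b-mono {j = suc j} i≤j j<p with m≤n⇒m<n∨m≡n i≤j
  ... | inj₁ (s≤s i≤j′) = ≤-trans (b-mono i≤j′ (≤-trans (n≤1+n j) j<p)) (<⇒≤ (increasing j j<p))
  ... | inj₂ refl       = ≤-refl

  b-strict : ∀ {i j} → i < j → j ≤ p → b i < b j
  b-strict {i} i<j j≤p = <-≤-trans (increasing i (≤-trans i<j j≤p)) (b-mono i<j j≤p)

  b-reflects-≤ : ∀ {i j} → i ≤ p → b i ≤ b j → i ≤ j
  b-reflects-≤ {i} {j} i≤p bi≤bj with i ≤? j
  ... | yes i≤j = i≤j
  ... | no  i≰j = ⊥-elim (<⇒≱ (b-strict (≰⇒> i≰j) i≤p) bi≤bj)

  between-consecutive : ∀ {i l} → i < p → l ≤ p → b i ≤ b l → b l ≤ b (suc i) → l ≡ i ⊎ l ≡ suc i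
  between-consecutive i<p l≤p bi≤bl bl≤bi+1 with m≤n⇒m<n∨m≡n (b-reflects-≤ (<⇒≤ i<p) bi≤bl)
  ... | inj₂ i≡l = inj₁ (sym i≡l)
  ... | inj₁ i<l = inj₂ (≤-antisym (b-reflects-≤ l≤p bl≤bi+1) i<l)

  parts-containing : ∀ {x y} → x ≤ y → y ≤ suc x → b 0 ≤ x → ∀ r → r < p →
    sum1 (suc r) (λ j → ind (inPart j x ∧ inPart j y))
      ≡ ind (y ≤ᵇ b (suc r)) + sum1 r (λ j → ind ((x ≡ᵇ b j) ∧ (y ≡ᵇ b j)))
  parts-containing {x} {y} x≤y _ b0≤x zero _
    rewrite ≤ᵇ-true b0≤x | ≤ᵇ-true (≤-trans b0≤x x≤y) with y ≤ᵇ b 1 in y≤b1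
  ... | true  rewrite ≤ᵇ-true (≤-trans x≤y (≤ᵇ⇒≤ y (b 1) (true⇒T y≤b1))) = refl
  ... | false rewrite ∧-zeroʳ (x ≤ᵇ b 1) = refl
  parts-containing {x} {y} x≤y y≤1+x b0≤x (suc r) r<p = begin
    sum1 (suc r) contains + contains (2 + r)
      ≡⟨ cong (_+ contains (2 + r)) (parts-containing x≤y y≤1+x b0≤x r (<⇒≤ r<p)) ⟩
    ind (y ≤ᵇ b (suc r)) + sum1 r shared + contains (2 + r)
      ≡⟨ xy∙z≈xz∙y (ind (y ≤ᵇ b (suc r))) (sum1 r shared) (contains (2 + r)) ⟩
    ind (y ≤ᵇ b (suc r)) + contains (2 + r) + sum1 r shared
      ≡⟨ cong (_+ sum1 r shared) (part-step x≤y y≤1+x (<⇒≤ (increasing (suc r) r<p))) ⟩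
    ind (y ≤ᵇ b (2 + r)) + shared (suc r) + sum1 r shared
      ≡⟨ +-assoc (ind (y ≤ᵇ b (2 + r))) (shared (suc r)) (sum1 r shared) ⟩
    ind (y ≤ᵇ b (2 + r)) + (shared (suc r) + sum1 r shared)
      ≡⟨ cong (ind (y ≤ᵇ b (2 + r)) +_) (+-comm (shared (suc r)) (sum1 r shared)) ⟩
    ind (y ≤ᵇ b (2 + r)) + (sum1 r shared + shared (suc r)) ∎
    where
    open ≡-Reasoning
    contains shared : ℕ → ℕ
    contains j = ind (inPart j x ∧ inPart j y)
    shared j = ind ((x ≡ᵇ b j) ∧ (y ≡ᵇ b j))

  part-multiplicity : ∀ {x y} → x ≤ suc y → y ≤ suc x → b 0 ≤ x → b 0 ≤ y → x ≤ b p → y ≤ b p →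
    sum1 p (λ j → ind (inPart j x ∧ inPart j y)) ≡ 1 + sum1 q (λ j → ind ((x ≡ᵇ b j) ∧ (y ≡ᵇ b j)))
  part-multiplicity {x} {y} x≤1+y y≤1+x b0≤x b0≤y x≤bp y≤bp with ≤-total x y
  ... | inj₁ x≤y rewrite parts-containing x≤y y≤1+x b0≤x q ≤-refl | ≤ᵇ-true y≤bp = refl
  ... | inj₂ y≤x rewrite sum1-cong p (λ j _ _ → cong ind (∧-comm (inPart j x) (inPart j y)))
                       | sum1-cong q (λ j _ _ → cong ind (∧-comm (x ≡ᵇ b j) (y ≡ᵇ b j)))
                       | parts-containing y≤x x≤1+y b0≤y q ≤-refl | ≤ᵇ-true x≤bp = refl

  partIndex : ℕ → ℕ → ℕ
  partIndex c zero    = 0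
  partIndex c (suc j) = if b j <ᵇ c then suc j else partIndex c j

  partIndex-correct : ∀ {i c} → b i < c → c ≤ b (suc i) → ∀ j → suc i ≤ j → j ≤ p → partIndex c j ≡ suc i
  partIndex-correct {i} {c} bi<c c≤bi+1 (suc j) (s≤s i≤j) j<p with m≤n⇒m<n∨m≡n i≤j
  ... | inj₂ refl rewrite <ᵇ-true bi<c = refl
  ... | inj₁ i<j rewrite <ᵇ-false (≤-trans c≤bi+1 (b-mono i<j (<⇒≤ j<p))) =
    partIndex-correct bi<c c≤bi+1 j i<j (<⇒≤ j<p)

module _ {n} (B : BubbleStructure n) where
  open BubbleStructure B

  inColumn : ℕ → Fin n → Bool
  inColumn c v = col v ≡ᵇ c

  dirEdge-near : ∀ u v → dirEdge B u v ≡ true → col u ≤ col v × col v ≤ suc (col u)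
  dirEdge-near u v uv with col u ≡ᵇ col v in same
  ... | true  = ≤-reflexive u≡v , ≤-trans (≤-reflexive (sym u≡v)) (n≤1+n (col u))
    where
    u≡v : col u ≡ col v
    u≡v = ≡ᵇ⇒≡ (col u) (col v) (true⇒T same)
  ... | false with col v ≡ᵇ suc (col u) in next
  ...   | true  = ≤-trans (n≤1+n (col u)) (≤-reflexive (sym v≡1+u)) , ≤-reflexive v≡1+u
    where
    v≡1+u : col v ≡ suc (col u)
    v≡1+u = ≡ᵇ⇒≡ (col v) (suc (col u)) (true⇒T next)
  dirEdge-near u v () | false | false

  bubbleAdj-near : ∀ u v → bubbleAdj B u v ≡ true → col u ≤ suc (col v) × col v ≤ suc (col u)
  bubbleAdj-near u v uv with dirEdge B u v in forward
  ... | true  = let (u≤v , v≤1+u) = dirEdge-near u v forward in m≤n⇒m≤1+n u≤v , v≤1+u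
  ... | false = let (v≤u , u≤1+v) = dirEdge-near v u (∧-trueʳ (not (toℕ u ≡ᵇ toℕ v)) uv)
                in u≤1+v , m≤n⇒m≤1+n v≤u

  bubbleAdj-same-column : ∀ u v → u ≢ v → col u ≡ col v → bubbleAdj B u v ≡ true
  bubbleAdj-same-column u v u≢v u≡v rewrite ≡ᵇ-false (u≢v ∘ toℕ-injective) | ≡ᵇ-true u≡v = refl

  inColumn-clique : ∀ (G : Graph n) → (∀ u v → Graph.adj G u v ≡ bubbleAdj B u v) → ∀ c → IsClique G (inColumn c)
  inColumn-clique G adj≡ c u v u≢v u∈c v∈c = trans (adj≡ u v) (bubbleAdj-same-column u v u≢v
    (trans (≡ᵇ⇒≡ _ _ (true⇒T u∈c)) (sym (≡ᵇ⇒≡ _ _ (true⇒T v∈c)))))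

  k≡0⇒no-vertex : k ≡ 0 → Fin n → ⊥
  k≡0⇒no-vertex k≡0 v with col-range v
  ... | 1≤c , c≤k with () ← ≤-trans 1≤c (subst (col v ≤_) k≡0 c≤k)

  no-parts⇒n≤1 : ∀ {b} → IsBorderSeq B 0 b → n ≤ 1
  no-parts⇒n≤1 borders with IsBorderSeq.first borders | IsBorderSeq.last borders
  ... | inj₁ (light₁ , b0≡1) | inj₁ (_ , b0≡k) =
    n≮n*n⇒n≤1 (subst (λ c → ¬ n < c * c) colSize₁≡n light₁)
    where
    colSize₁≡n : colSize B 1 ≡ n
    colSize₁≡n = count-all λ v → ≡ᵇ-true (≤-antisym
      (subst (col v ≤_) (trans (sym b0≡k) b0≡1) (proj₂ (col-range v))) (proj₁ (col-range v)))
  ... | inj₁ (_ , b0≡1) | inj₂ (_ , b0≡1+k) =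
    uninhabited⇒≤1 (k≡0⇒no-vertex (suc-injective (trans (sym b0≡1+k) b0≡1)))
  ... | inj₂ (_ , b0≡0) | inj₁ (_ , b0≡k) = uninhabited⇒≤1 (k≡0⇒no-vertex (trans (sym b0≡k) b0≡0))
  ... | inj₂ (_ , b0≡0) | inj₂ (_ , b0≡1+k) with () ← trans (sym b0≡0) b0≡1+k

module HeavyParts {n} (G : Graph n) (B : BubbleStructure n)
  (adj≡ : ∀ u v → Graph.adj G u v ≡ bubbleAdj B u v)
  (q : ℕ) (b : ℕ → ℕ) (borders : IsBorderSeq B (suc q) b) (S : Fin n → Bool) where
  open BubbleStructure B
  open IsBorderSeq borders
  open Borders b q increasing

  AgreesOnLight : (Fin n → Bool) → Set
  AgreesOnLight X = ∀ v → lightV B v → X v ≡ S v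

  innerCut : ℕ
  innerCut = sum1 q (λ j → sizeIn B b S j * sizeOut B b S j)

  b₀≤col : ∀ v → b 0 ≤ col v
  b₀≤col v with first
  ... | inj₁ (_ , b0≡1) rewrite b0≡1 = proj₁ (col-range v)
  ... | inj₂ (_ , b0≡0) rewrite b0≡0 = z≤n

  col≤bₚ : ∀ v → col v ≤ b p
  col≤bₚ v with last
  ... | inj₁ (_ , bp≡k)   rewrite bp≡k   = proj₂ (col-range v)
  ... | inj₂ (_ , bp≡1+k) rewrite bp≡1+k = m≤n⇒m≤1+n (proj₂ (col-range v))

  crossing-multiplicity : ∀ X u v → crosses G X u v ≡ true →
    sum1 p (λ j → ind (partV B b j u ∧ partV B b j v))
      ≡ 1 + sum1 q (λ j → ind (inColumn B (b j) u ∧ inColumn B (b j) v))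
  crossing-multiplicity X u v uv =
    part-multiplicity (proj₁ near) (proj₂ near) (b₀≤col u) (b₀≤col v) (col≤bₚ u) (col≤bₚ v)
    where
    near : col u ≤ suc (col v) × col v ≤ suc (col u)
    near = bubbleAdj-near B u v (trans (sym (adj≡ u v)) (∧-trueˡ _ (∧-trueʳ (toℕ u <ᵇ toℕ v) uv)))

  -- A crossing edge is counted once, plus once more for each inner border column containing it.
  parts-cutSize : ∀ X → sum1 p (λ j → cutSize G (partV B b j) X)
                          ≡ cutSize G allV X + sum1 q (λ j → cutSize G (inColumn B (b j)) X)
  parts-cutSize X = begin
    sum1 p (λ j → cutSize G (partV B b j) X)
      ≡⟨ sum1-cutSize G p (partV B b) X ⟩
    sumF (λ u → sumF (λ v → crossing u v * sum1 p (λ j → ind (partV B b j u ∧ partV B b j v))))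
      ≡⟨ sumF-cong (λ u → sumF-cong (λ v → ind-guarded-* (crosses G X u v) (crossing-multiplicity X u v))) ⟩
    sumF (λ u → sumF (λ v → crossing u v * (1 + inner u v)))
      ≡⟨ sumF-cong (λ u → trans (sumF-cong (λ v → *-distribˡ-+ (crossing u v) 1 (inner u v)))
                                (sumF-+ (once u) (repeated u))) ⟩
    sumF (λ u → sumF (once u) + sumF (repeated u))
      ≡⟨ sumF-+ (λ u → sumF (once u)) (λ u → sumF (repeated u)) ⟩
    sumF (λ u → sumF (once u)) + sumF (λ u → sumF (repeated u))
      ≡⟨ sym (cong₂ _+_ (cutSize-weighted G allV X) (sum1-cutSize G q (λ j → inColumn B (b j)) X)) ⟩
    cutSize G allV X + sum1 q (λ j → cutSize G (inColumn B (b j)) X) ∎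
    where
    open ≡-Reasoning
    crossing inner once repeated : Fin n → Fin n → ℕ
    crossing u v = ind (crosses G X u v)
    inner    u v = sum1 q (λ j → ind (inColumn B (b j) u ∧ inColumn B (b j) v))
    once     u v = crossing u v * 1
    repeated u v = crossing u v * inner u v

  inner-cutSize : ∀ X → AgreesOnLight X → sum1 q (λ j → cutSize G (inColumn B (b j)) X) ≡ innerCut
  inner-cutSize X X-agrees = sum1-cong q λ j _ j≤q →
    trans (cutSize-clique G (inColumn B (b j)) X (inColumn-clique B G adj≡ (b j)))
          (cong₂ _*_ (count-guarded-cong (inColumn B (b j)) (X≡S j≤q))
                     (count-guarded-cong (inColumn B (b j)) (λ v v∈j → cong not (X≡S j≤q v v∈j))))
    where
    X≡S : ∀ {j} → j ≤ q → ∀ v → inColumn B (b j) v ≡ true → X v ≡ S v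
    X≡S {j} j≤q v v∈j = X-agrees v (subst (Light B) (sym (≡ᵇ⇒≡ _ _ (true⇒T v∈j))) (borders-light j (m≤n⇒m≤1+n j≤q)))

  agreeing-parts-cutSize : ∀ X → AgreesOnLight X → sum1 p (λ j → cutSize G (partV B b j) X) ≡ cutSize G allV X + innerCut
  agreeing-parts-cutSize X X-agrees = trans (parts-cutSize X) (cong (cutSize G allV X +_) (inner-cutSize X X-agrees))

  agrees-on-borders : ∀ X → AgreesOnLight X → ∀ j → j ≤ p → ∀ v → borderV B b j v → X v ≡ S v
  agrees-on-borders X X-agrees j j≤p v (inj₁ v∈Cj-1) =
    X-agrees v (subst (Light B) (sym v∈Cj-1) (borders-light (j ∸ 1) (≤-trans (m∸n≤m j 1) j≤p)))
  agrees-on-borders X X-agrees j j≤p v (inj₂ v∈Cj) =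
    X-agrees v (subst (Light B) (sym v∈Cj) (borders-light j j≤p))

  light-in-part⇒border : ∀ i → suc i ≤ p → ∀ v → partV B b (suc i) v ≡ true → lightV B v → borderV B b (suc i) v
  light-in-part⇒border i i<p v v∈part light
    with all-light-borders (col v) (proj₁ (col-range v)) (proj₂ (col-range v)) light
  ... | l , l≤p , bl≡col with between-consecutive i<p l≤p
          (subst (b i ≤_) (sym bl≡col) (proj₁ (inPart-bounds (suc i) (col v) v∈part)))
          (subst (_≤ b (suc i)) (sym bl≡col) (proj₂ (inPart-bounds (suc i) (col v) v∈part)))
  ...   | inj₁ refl = inj₁ (sym bl≡col)
  ...   | inj₂ refl = inj₂ (sym bl≡col)

  heavy? : ∀ c → Dec (Heavy B c)
  heavy? c = n <? colSize B c * colSize B c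

  glue : (ℕ → Fin n → Bool) → Fin n → Bool
  glue Y v with heavy? (col v)
  ... | yes _ = Y (partIndex (col v) p) v
  ... | no  _ = S v

  glue-agrees : ∀ Y → AgreesOnLight (glue Y)
  glue-agrees Y v light with heavy? (col v)
  ... | yes heavy = ⊥-elim (light heavy)
  ... | no  _     = refl

  glue-on-part : ∀ Y → (∀ j → 1 ≤ j → j ≤ p → ∀ v → borderV B b j v → Y j v ≡ S v) →
    ∀ j → 1 ≤ j → j ≤ p → ∀ v → partV B b j v ≡ true → glue Y v ≡ Y j v
  glue-on-part Y Y-borders (suc i) _ i<p v v∈part with heavy? (col v)
  ... | yes heavy = cong (λ j → Y j v) (partIndex-correct bi<col col≤bi+1 p i<p ≤-refl)
    where
    bi<col : b i < col v
    bi<col = ≤∧≢⇒< (proj₁ (inPart-bounds (suc i) (col v) v∈part))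
                   (λ bi≡col → borders-light i (<⇒≤ i<p) (subst (Heavy B) (sym bi≡col) heavy))
    col≤bi+1 : col v ≤ b (suc i)
    col≤bi+1 = proj₂ (inPart-bounds (suc i) (col v) v∈part)
  ... | no light = sym (Y-borders (suc i) (s≤s z≤n) i<p v (light-in-part⇒border i i<p v v∈part light))

  mcs-decomposition : ∀ m → IsMcs G allV (lightV B) S m →
    ∀ ms → (∀ j → 1 ≤ j → j ≤ p → IsMcs G (partV B b j) (borderV B b j) S (ms j)) →
    m + innerCut ≡ sum1 p ms
  mcs-decomposition m ((X , X-agrees , X-cut) , m-max) ms mcs-parts = ≤-antisym upper lower
    where
    open ≤-Reasoning

    upper : m + innerCut ≤ sum1 p ms
    upper = begin
      m + innerCut                             ≡⟨ cong (_+ innerCut) (sym X-cut) ⟩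
      cutSize G allV X + innerCut              ≡⟨ agreeing-parts-cutSize X X-agrees ⟨
      sum1 p (λ j → cutSize G (partV B b j) X) ≤⟨ sum1-mono p (λ j 1≤j j≤p →
                                                   proj₂ (mcs-parts j 1≤j j≤p) X (agrees-on-borders X X-agrees j j≤p)) ⟩
      sum1 p ms                                ∎

    optimal-part-cuts : Σ (ℕ → Fin n → Bool) λ Y → ∀ j → 1 ≤ j → j ≤ p →
      (∀ v → borderV B b j v → Y j v ≡ S v) × cutSize G (partV B b j) (Y j) ≡ ms j
    optimal-part-cuts = bounded-choice p S (λ j 1≤j j≤p → proj₁ (mcs-parts j 1≤j j≤p))

    Y : ℕ → Fin n → Bool
    Y = proj₁ optimal-part-cuts

    Y-borders : ∀ j → 1 ≤ j → j ≤ p → ∀ v → borderV B b j v → Y j v ≡ S v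
    Y-borders j 1≤j j≤p = proj₁ (proj₂ optimal-part-cuts j 1≤j j≤p)

    lower : sum1 p ms ≤ m + innerCut
    lower = begin
      sum1 p ms                                      ≡⟨ sum1-cong p (λ j 1≤j j≤p → proj₂ (proj₂ optimal-part-cuts j 1≤j j≤p)) ⟨
      sum1 p (λ j → cutSize G (partV B b j) (Y j))   ≡⟨ sum1-cong p (λ j 1≤j j≤p → cutSize-cong G (partV B b j)
                                                          (λ v v∈j → sym (glue-on-part Y Y-borders j 1≤j j≤p v v∈j))) ⟩
      sum1 p (λ j → cutSize G (partV B b j) (glue Y)) ≡⟨ agreeing-parts-cutSize (glue Y) (glue-agrees Y) ⟩
      cutSize G allV (glue Y) + innerCut             ≤⟨ +-monoˡ-≤ innerCut (m-max (glue Y) (glue-agrees Y)) ⟩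
      m + innerCut                                   ∎

lemma18 : ∀ {n} (G : Graph n) → IsMixedUnitInterval G →
    (B : BubbleStructure n) → IsUModel B →
    (∀ u v → Graph.adj G u v ≡ bubbleAdj B u v) →
    (p : ℕ) (b : ℕ → ℕ) → IsBorderSeq B p b →
    (S : Fin n → Bool) → (∀ v → S v ≡ true → lightV B v) →
    (m : ℕ) → IsMcs G allV (lightV B) S m →
    (ms : ℕ → ℕ) → (∀ j → 1 ≤ j → j ≤ p → IsMcs G (partV B b j) (borderV B b j) S (ms j)) →
    m + sum1 (p ∸ 1) (λ j → sizeIn B b S j * sizeOut B b S j) ≡ sum1 p ms
lemma18 G _ B _ adj≡ zero b borders S _ m ((X , _ , X-cut) , _) _ _ = begin
  m + 0              ≡⟨ +-identityʳ m ⟩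
  m                  ≡⟨ X-cut ⟨
  cutSize G allV X   ≡⟨ cutSize-trivial G allV X (no-parts⇒n≤1 B borders) ⟩
  0                  ∎
  where open ≡-Reasoning
lemma18 G _ B _ adj≡ (suc q) b borders S _ m m-mcs ms ms-mcs =
  HeavyParts.mcs-decomposition G B adj≡ q b borders S m m-mcs ms ms-mcs
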